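{- Let $q$ and $n$ be two coprime positive integers, and let $I\subseteq\{1,\ldots,m\}$. Then \[ |\mathcal{F}_I|=\frac{\gcd\big(n,\gcd(s_i)_{i\in I}\big)}{n}\prod_{i\in I}\big(q^{\ell_i}-1\big). \]
   Context: Consider the equivalence relation on $\mathbb{Z}_n$ generated by $z\sim qz$; let integers $s_1,\ldots,s_m$ represent its $m$ classes, the class of $s_i$ being $S_i=\{s_i,qs_i,\ldots,q^{\ell_i-1}s_i\}$ with $\ell_i$ the smallest positive integer such that $q^{\ell_i}s_i\equiv s_i\pmod n$. Let $\mathcal{F}$ be the set of functions $f:\mathbb{Z}_n\to\{0,1,\ldots,q-1\}$ with $\sum_{z\in\mathbb{Z}_n} z f(z)\equiv 0\pmod n$. For such $f$, let $L_{q-1}(f)=\{z\in\mathbb{Z}_n: f(z)=q-1\}$. For $I\subseteq\{1,\ldots,m\}$, $\mathcal{F}_I=\{f\in\mathcal{F}:\ \text{for every } i,\ S_i\subseteq L_{q-1}(f) \text{ iff } i\notin I\}$. For $I=\emptyset$, $\gcd(n,\gcd(s_i)_{i\in I})$ is interpreted as $n$. -}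

module Defs where

open import Data.Nat using (ℕ; zero; suc; _+_; _*_; _∸_; _^_; _<_; NonZero)
open import Data.Nat.DivMod using (_%_)
open import Data.Nat.Divisibility using (_∣_; _∣?_)
open import Data.Nat.GCD using (gcd)
open import Data.Nat.Properties using (_≟_)
open import Data.Fin using (Fin; toℕ)
open import Data.Fin.Properties using (all?; any?)
open import Data.Fin.Subset using (Subset; _∈_; _∉_)
open import Data.Fin.Subset.Properties using (_∈?_)
open import Data.Vec using (Vec; []; _∷_; lookup)
open import Data.List using (List; []; _∷_; map; concatMap; allFin; foldr; length; filter)
open import Data.Nat.ListAction using (sum; product)
open import Data.Product using (Σ; _×_; ∃; _,_)
open import Relation.Nullary using (Dec; ¬_; ¬?)
open import Relation.Nullary.Decidable using (_×-dec_; _→-dec_)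
open import Relation.Binary.PropositionalEquality using (_≡_)
open import Relation.Binary.Construct.Closure.Equivalence using (EqClosure)

-- Elements of ℤ_n are represented by Fin n (residues 0..n-1).

Step : (q n : ℕ) .{{_ : NonZero n}} → Fin n → Fin n → Set
Step q n z w = toℕ w ≡ (q * toℕ z) % n

Equiv : (q n : ℕ) .{{_ : NonZero n}} → Fin n → Fin n → Set
Equiv q n = EqClosure (Step q n)

InClass : (q n : ℕ) .{{_ : NonZero n}} → (s : Fin n) (ℓ : ℕ) → Fin n → Set
InClass q n s ℓ z = ∃ λ (k : Fin ℓ) → toℕ z ≡ (q ^ toℕ k * toℕ s) % n

inClass? : (q n : ℕ) .{{_ : NonZero n}} → (s : Fin n) (ℓ : ℕ) (z : Fin n) → Dec (InClass q n s ℓ z)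
inClass? q n s ℓ z = any? (λ k → toℕ z ≟ (q ^ toℕ k * toℕ s) % n)

-- Functions f : ℤ_n → {0,…,q-1} are represented as vectors f ∈ Vec (Fin q) n,
-- f(z) = lookup f z.

ClassInL : (q n : ℕ) .{{_ : NonZero n}} → (s : Fin n) (ℓ : ℕ) → Vec (Fin q) n → Set
ClassInL q n s ℓ f = ∀ z → InClass q n s ℓ z → toℕ (lookup f z) ≡ q ∸ 1

classInL? : (q n : ℕ) .{{_ : NonZero n}} → (s : Fin n) (ℓ : ℕ) (f : Vec (Fin q) n) → Dec (ClassInL q n s ℓ f)
classInL? q n s ℓ f = all? (λ z → inClass? q n s ℓ z →-dec (toℕ (lookup f z) ≟ q ∸ 1))

weightSum : {q n : ℕ} → Vec (Fin q) n → ℕ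
weightSum {n = n} f = sum (map (λ z → toℕ z * toℕ (lookup f z)) (allFin n))

InFI : (q n m : ℕ) .{{_ : NonZero n}} → (s : Fin m → Fin n) (ℓ : Fin m → ℕ) (I : Subset m)
       → Vec (Fin q) n → Set
InFI q n m s ℓ I f = (n ∣ weightSum f) × (∀ i → (i ∉ I → ClassInL q n (s i) (ℓ i) f)
                                                × (i ∈ I → ¬ ClassInL q n (s i) (ℓ i) f))

inFI? : (q n m : ℕ) .{{_ : NonZero n}} → (s : Fin m → Fin n) (ℓ : Fin m → ℕ) (I : Subset m)
        → (f : Vec (Fin q) n) → Dec (InFI q n m s ℓ I f)
inFI? q n m s ℓ I f = (n ∣? weightSum f)
  ×-dec all? (λ i → (¬? (i ∈? I) →-dec classInL? q n (s i) (ℓ i) f)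
                 ×-dec (i ∈? I →-dec ¬? (classInL? q n (s i) (ℓ i) f)))

-- All functions Fin n → Fin q, each listed exactly once.
allVecs : (q n : ℕ) → List (Vec (Fin q) n)
allVecs q zero    = [] ∷ []
allVecs q (suc n) = concatMap (λ x → map (x ∷_) (allVecs q n)) (allFin q)

cardFI : (q n m : ℕ) .{{_ : NonZero n}} → (s : Fin m → Fin n) (ℓ : Fin m → ℕ) (I : Subset m) → ℕ
cardFI q n m s ℓ I = length (filter (inFI? q n m s ℓ I) (allVecs q n))

-- gcd(n, gcd(s_i)_{i ∈ I})  (equals n when I = ∅)
gcdI : (n m : ℕ) (s : Fin m → Fin n) (I : Subset m) → ℕ
gcdI n m s I = foldr (λ i g → gcd (toℕ (s i)) g) n (filter (_∈? I) (allFin m))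

prodI : (q m : ℕ) (ℓ : Fin m → ℕ) (I : Subset m) → ℕ
prodI q m ℓ I = product (map (λ i → q ^ ℓ i ∸ 1) (filter (_∈? I) (allFin m)))

module Submission where

-- Multiplication by q permutes ℤ_n, and S_i lists its orbit through s_i
-- without repetition.  Listing ℤ_n orbit by orbit turns f : ℤ_n → {0,…,q-1}
-- into a word of m blocks u_i of lengths ℓ_i such that S_i ⊆ L_{q-1}(f) iff
-- u_i is the all-(q-1) block, and Σ_z z f(z) ≡ Σ_i s_i · val(u_i) (mod n),
-- val(u) being the number with base-q digits u (so val runs once over
-- 0,…,q^ℓ-1).  With G and P the two factors above, induction on the number
-- of blocks shows, for every residue r,
--   n · #{admissible words with n ∣ r + Σ_i s_i val(u_i)} = [G ∣ r] · G · P: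
-- a block outside I has value q^ℓ-1 and s_i (q^ℓ-1) ≡ 0 (mod n); a block in
-- I ranges over 0,…,q^ℓ-2, where a linear congruence count applies.

open import Defs
open import Data.Nat
  using (ℕ; zero; suc; _+_; _*_; _∸_; _^_; _≤_; _<_; z≤n; s≤s; NonZero; ≢-nonZero; ≢-nonZero⁻¹)
open import Data.Nat.Properties
open import Data.Nat.Divisibility
open import Data.Nat.DivMod
open import Data.Nat.GCD
open import Data.Nat.Coprimality using (Coprime; coprime-divisor; coprime-/gcd)
import Data.Nat.Coprimality as Coprimality
open import Data.Nat.ListAction using (sum)
open import Data.Nat.Tactic.RingSolver using (solve-∀)
open import Data.Fin
  using (Fin; zero; suc; toℕ; fromℕ; fromℕ<; opposite; _↑ˡ_; _↑ʳ_; combine; remQuot; splitAt; join)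
import Data.Fin as Fin
open import Data.Fin.Properties
  using ( toℕ-injective; toℕ-fromℕ; toℕ-fromℕ<; toℕ<n; opposite-involutive; opposite-suc
        ; remQuot-combine; combine-remQuot; toℕ-combine; splitAt-↑ˡ; splitAt-↑ʳ; join-splitAt; all?)
open import Data.Fin.Subset using (Subset; _∈_; _∉_; inside; outside; Side)
open import Data.Fin.Subset.Properties using (_∈?_)
open import Data.Vec using (Vec; []; _∷_; lookup; tabulate; _++_; replicate)
open import Data.Vec.Properties
  using ( lookup∘tabulate; tabulate-cong; tabulate∘lookup; lookup-replicate; lookup-++ˡ; lookup-++ʳ
        ; ≡-dec; []=⇒lookup; lookup⇒[]=)
open import Data.List using (List; []; _∷_; filter; allFin; foldr; length; concatMap)
import Data.List as List
open import Data.List.Properties using (map-++; map-cong; map-∘; map-tabulate; foldr-map)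
open import Data.Nat.ListAction.Properties using (sum-++)
import Algebra.Properties.CommutativeMonoid.Sum as CommutativeMonoidSum
open import Data.Bool using (true; false)
open import Data.Empty using (⊥-elim)
open import Data.Sum using (inj₁; inj₂)
open import Data.Product using (Σ; ∃; _×_; _,_; proj₁; proj₂)
open import Function using (_∘_; _↔_; mk↔ₛ′; Inverse)
open import Relation.Nullary using (Dec; yes; no; ¬_; ¬?; does)
open import Relation.Nullary.Decidable using (_×-dec_)
open import Relation.Binary.PropositionalEquality
open import Relation.Binary.Construct.Closure.ReflexiveTransitive using (ε; _◅_; _◅◅_)
open import Relation.Binary.Construct.Closure.Symmetric using (SymClosure; fwd; bwd)
import Relation.Binary.Construct.Closure.Equivalence as EqClosure

-- Indicators and finite sums

𝟙 : {P : Set} → Dec P → ℕ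
𝟙 (yes _) = 1
𝟙 (no _)  = 0

𝟙-cong : {P Q : Set} (p : Dec P) (q : Dec Q) → (P → Q) → (Q → P) → 𝟙 p ≡ 𝟙 q
𝟙-cong (yes _) (yes _) _ _ = refl
𝟙-cong (yes p) (no ¬q) f _ = ⊥-elim (¬q (f p))
𝟙-cong (no ¬p) (yes q) _ g = ⊥-elim (¬p (g q))
𝟙-cong (no _)  (no _)  _ _ = refl

𝟙-yes : {P : Set} (p : Dec P) → P → 𝟙 p ≡ 1
𝟙-yes (yes _) _ = refl
𝟙-yes (no ¬p) p = ⊥-elim (¬p p)

𝟙-no : {P : Set} (p : Dec P) → ¬ P → 𝟙 p ≡ 0
𝟙-no (yes p) ¬p = ⊥-elim (¬p p)
𝟙-no (no _)  _  = refl

𝟙-× : {P Q : Set} (p : Dec P) (q : Dec Q) → 𝟙 (p ×-dec q) ≡ 𝟙 p * 𝟙 q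
𝟙-× (yes _) (yes _) = refl
𝟙-× (yes _) (no _)  = refl
𝟙-× (no _)  (yes _) = refl
𝟙-× (no _)  (no _)  = refl

length-filter : {A : Set} {P : A → Set} (P? : ∀ x → Dec (P x)) (xs : List A) →
                length (filter P? xs) ≡ sum (List.map (𝟙 ∘ P?) xs)
length-filter P? [] = refl
length-filter P? (x ∷ xs) with P? x
... | yes _ = cong suc (length-filter P? xs)
... | no _  = length-filter P? xs

sum-map-cong : {A : Set} (xs : List A) {f g : A → ℕ} → (∀ x → f x ≡ g x) →
               sum (List.map f xs) ≡ sum (List.map g xs)
sum-map-cong xs eq = cong sum (map-cong eq xs)

sum-map-map : {A B : Set} (f : A → B) (h : B → ℕ) (xs : List A) →
              sum (List.map h (List.map f xs)) ≡ sum (List.map (h ∘ f) xs)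
sum-map-map f h xs = cong sum (sym (map-∘ xs))

sum-map-concatMap : {A B : Set} (g : A → List B) (h : B → ℕ) (xs : List A) →
  sum (List.map h (concatMap g xs)) ≡ sum (List.map (λ x → sum (List.map h (g x))) xs)
sum-map-concatMap g h []       = refl
sum-map-concatMap g h (x ∷ xs) = begin
    sum (List.map h (g x List.++ concatMap g xs))
  ≡⟨ cong sum (map-++ h (g x) (concatMap g xs)) ⟩
    sum (List.map h (g x) List.++ List.map h (concatMap g xs))
  ≡⟨ sum-++ (List.map h (g x)) _ ⟩
    sum (List.map h (g x)) + sum (List.map h (concatMap g xs))
  ≡⟨ cong (sum (List.map h (g x)) +_) (sum-map-concatMap g h xs) ⟩
    sum (List.map (λ x → sum (List.map h (g x))) (x ∷ xs))
  ∎ where open ≡-Reasoning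

module FinSum = CommutativeMonoidSum +-0-commutativeMonoid

∑ : ∀ n → (Fin n → ℕ) → ℕ
∑ n = FinSum.sum {n}

∑-cong : ∀ n {f g : Fin n → ℕ} → (∀ i → f i ≡ g i) → ∑ n f ≡ ∑ n g
∑-cong n = FinSum.sum-cong-≗ {n}

sum-allFin : ∀ n (h : Fin n → ℕ) → sum (List.map h (allFin n)) ≡ ∑ n h
sum-allFin n h = trans (cong sum (map-tabulate (λ i → i) h)) (tabulated n h)
  where
    tabulated : ∀ n (h : Fin n → ℕ) → sum (List.tabulate h) ≡ ∑ n h
    tabulated zero    h = refl
    tabulated (suc n) h = cong (h zero +_) (tabulated n (h ∘ suc))

∑-split : ∀ a b (h : Fin (a + b) → ℕ) → ∑ (a + b) h ≡ ∑ a (h ∘ (_↑ˡ b)) + ∑ b (h ∘ (a ↑ʳ_))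
∑-split zero    b h = refl
∑-split (suc a) b h = trans (cong (h zero +_) (∑-split a b (h ∘ suc))) (sym (+-assoc (h zero) _ _))

∑-combine : ∀ a b (h : Fin (a * b) → ℕ) → ∑ (a * b) h ≡ ∑ a (λ i → ∑ b (λ j → h (combine i j)))
∑-combine zero    b h = refl
∑-combine (suc a) b h =
  trans (∑-split b (a * b) h) (cong (∑ b (h ∘ (_↑ˡ (a * b))) +_) (∑-combine a b (h ∘ (b ↑ʳ_))))

∑-*ˡ : ∀ n c (h : Fin n → ℕ) → ∑ n (λ i → c * h i) ≡ c * ∑ n h
∑-*ˡ zero    c h = sym (*-zeroʳ c)
∑-*ˡ (suc n) c h = trans (cong (c * h zero +_) (∑-*ˡ n c (h ∘ suc))) (sym (*-distribˡ-+ c (h zero) _))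

∑-mod : ∀ n .{{_ : NonZero n}} N (a b : Fin N → ℕ) → (∀ i → a i % n ≡ b i % n) → ∑ N a % n ≡ ∑ N b % n
∑-mod n zero    a b eq = refl
∑-mod n (suc N) a b eq = begin
    (a zero + ∑ N (a ∘ suc)) % n
  ≡⟨ %-distribˡ-+ (a zero) _ n ⟩
    (a zero % n + ∑ N (a ∘ suc) % n) % n
  ≡⟨ cong₂ (λ x y → (x + y) % n) (eq zero) (∑-mod n N (a ∘ suc) (b ∘ suc) (eq ∘ suc)) ⟩
    (b zero % n + ∑ N (b ∘ suc) % n) % n
  ≡⟨ sym (%-distribˡ-+ (b zero) _ n) ⟩
    (b zero + ∑ N (b ∘ suc)) % n
  ∎ where open ≡-Reasoning

∑< : ℕ → (ℕ → ℕ) → ℕ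
∑< zero    F = 0
∑< (suc M) F = F 0 + ∑< M (F ∘ suc)

∑-toℕ : ∀ M (F : ℕ → ℕ) → ∑ M (F ∘ toℕ) ≡ ∑< M F
∑-toℕ zero    F = refl
∑-toℕ (suc M) F = cong (F 0 +_) (∑-toℕ M (F ∘ suc))

∑<-cong : ∀ M {F G : ℕ → ℕ} → (∀ x → x < M → F x ≡ G x) → ∑< M F ≡ ∑< M G
∑<-cong zero    eq = refl
∑<-cong (suc M) eq = cong₂ _+_ (eq 0 (s≤s z≤n)) (∑<-cong M (λ x x<M → eq (suc x) (s≤s x<M)))

∑<-+ : ∀ a b F → ∑< (a + b) F ≡ ∑< a F + ∑< b (λ x → F (a + x))
∑<-+ zero    b F = refl
∑<-+ (suc a) b F = trans (cong (F 0 +_) (∑<-+ a b (F ∘ suc))) (sym (+-assoc (F 0) _ _))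

∑<-last : ∀ M F → ∑< (suc M) F ≡ ∑< M F + F M
∑<-last M F = begin
    ∑< (suc M) F          ≡⟨ cong (λ k → ∑< k F) (+-comm 1 M) ⟩
    ∑< (M + 1) F          ≡⟨ ∑<-+ M 1 F ⟩
    ∑< M F + (F (M + 0) + 0) ≡⟨ cong (∑< M F +_) (trans (+-identityʳ _) (cong F (+-identityʳ M))) ⟩
    ∑< M F + F M          ∎
  where open ≡-Reasoning

∑<-*ʳ : ∀ M F c → ∑< M (λ x → F x * c) ≡ ∑< M F * c
∑<-*ʳ zero    F c = refl
∑<-*ʳ (suc M) F c = trans (cong (F 0 * c +_) (∑<-*ʳ M (F ∘ suc) c)) (sym (*-distribʳ-+ c (F 0) _))

∑<-zero : ∀ M F → (∀ x → x < M → F x ≡ 0) → ∑< M F ≡ 0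
∑<-zero M F vanish = trans (∑<-cong M vanish) (zeros M)
  where zeros : ∀ M → ∑< M (λ _ → 0) ≡ 0
        zeros zero    = refl
        zeros (suc M) = zeros M

∑<-periodic : ∀ t e F → (∀ x → F (e + x) ≡ F x) → ∑< (t * e) F ≡ t * ∑< e F
∑<-periodic zero    e F per = refl
∑<-periodic (suc t) e F per = trans (∑<-+ e (t * e) F)
  (cong (∑< e F +_) (trans (∑<-cong (t * e) (λ x _ → per x)) (∑<-periodic t e F per)))

∑<-unique : ∀ e {P : ℕ → Set} (P? : ∀ x → Dec (P x)) x₀ → x₀ < e → P x₀ →
            (∀ x → x < e → P x → x ≡ x₀) → ∑< e (𝟙 ∘ P?) ≡ 1
∑<-unique (suc e) P? zero _ p₀ only = cong₂ _+_ (𝟙-yes (P? 0) p₀)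
  (∑<-zero e _ (λ x x<e → 𝟙-no (P? (suc x)) (λ p → 1+n≢0 (only (suc x) (s≤s x<e) p))))
∑<-unique (suc e) P? (suc x₀) (s≤s x₀<e) p₀ only = cong₂ _+_
  (𝟙-no (P? 0) (λ p → 1+n≢0 (sym (only 0 (s≤s z≤n) p))))
  (∑<-unique e (P? ∘ suc) x₀ x₀<e p₀ (λ x x<e p → suc-injective (only (suc x) (s≤s x<e) p)))

∑<-only-last : ∀ L (F : ℕ → ℕ) → ∑< (suc L) (λ x → 𝟙 (x ≟ L) * F x) ≡ F L
∑<-only-last L F = begin
    ∑< (suc L) E                ≡⟨ ∑<-last L E ⟩
    ∑< L E + E L                ≡⟨ cong₂ _+_ (∑<-zero L E (λ x x<L → cong (_* F x) (𝟙-no (x ≟ L) (<⇒≢ x<L))))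
                                             (cong (_* F L) (𝟙-yes (L ≟ L) refl)) ⟩
    0 + (F L + 0)               ≡⟨ +-identityʳ (F L) ⟩
    F L                         ∎
  where open ≡-Reasoning
        E : ℕ → ℕ
        E x = 𝟙 (x ≟ L) * F x

∑<-except-last : ∀ L (F : ℕ → ℕ) → ∑< (suc L) (λ x → 𝟙 (¬? (x ≟ L)) * F x) ≡ ∑< L F
∑<-except-last L F = begin
    ∑< (suc L) E   ≡⟨ ∑<-last L E ⟩
    ∑< L E + E L   ≡⟨ cong₂ _+_ (∑<-cong L (λ x x<L → trans (cong (_* F x) (𝟙-yes (¬? (x ≟ L)) (<⇒≢ x<L)))
                                                           (+-identityʳ (F x))))
                                (cong (_* F L) (𝟙-no (¬? (L ≟ L)) (λ L≢L → L≢L refl))) ⟩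
    ∑< L F + 0     ≡⟨ +-identityʳ _ ⟩
    ∑< L F         ∎
  where open ≡-Reasoning
        E : ℕ → ℕ
        E x = 𝟙 (¬? (x ≟ L)) * F x

-- Linear congruences r + s x ≡ 0 (mod G)

-- Bézout, in the form needed here: gcd(s,G) + s x ≡ 0 (mod G) is solvable.
gcd+multiple-divisible : ∀ s G₁ → ∃ λ x → suc G₁ ∣ gcd s (suc G₁) + s * x
gcd+multiple-divisible s G₁ with Bézout.identity (gcd-GCD s (suc G₁))
... | Bézout.Identity.-+ x y eq = x , divides y (trans (cong (gcd s (suc G₁) +_) (*-comm s x)) eq)
... | Bézout.Identity.+- x y eq = x * G₁ , divides (d + G₁ * y) (begin
      d + s * (x * G₁)          ≡⟨ rearrange d s x G₁ ⟩
      d + G₁ * (x * s)          ≡⟨ cong (λ t → d + G₁ * t) (sym eq) ⟩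
      d + G₁ * (d + y * suc G₁) ≡⟨ factor d y G₁ ⟩
      (d + G₁ * y) * suc G₁     ∎)
  where
    open ≡-Reasoning
    d = gcd s (suc G₁)
    rearrange : ∀ d s x G₁ → d + s * (x * G₁) ≡ d + G₁ * (x * s)
    rearrange = solve-∀
    factor : ∀ d y G₁ → d + G₁ * (d + y * suc G₁) ≡ (d + G₁ * y) * suc G₁
    factor = solve-∀

congruence-solvable : ∀ s G r .{{_ : NonZero G}} → gcd s G ∣ r → ∃ λ x → G ∣ r + s * x
congruence-solvable s (suc G₁) r (divides c r≡cd) with gcd+multiple-divisible s G₁
... | x , G∣d+sx = c * x , subst (suc G₁ ∣_) scale (∣n⇒∣m*n c G∣d+sx)
  where
    scale : c * (gcd s (suc G₁) + s * x) ≡ r + s * (c * x)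
    scale = trans (distribute c (gcd s (suc G₁)) s x) (cong (_+ s * (c * x)) (sym r≡cd))
      where distribute : ∀ c d s x → c * (d + s * x) ≡ c * d + s * (c * x)
            distribute = solve-∀

multiple-below⇒zero : ∀ {e δ} → e ∣ δ → δ < e → δ ≡ 0
multiple-below⇒zero {δ = zero}  _   _   = refl
multiple-below⇒zero {δ = suc _} e∣δ δ<e = ⊥-elim (>⇒∤ δ<e e∣δ)

-- Counting the solutions of r + s x ≡ 0 (mod G) in a range 0 ≤ x < L that
-- is a union of periods (G ∣ s L).  With d = gcd(s,G) the solutions are
-- e-periodic for e = G/d, one per period when d ∣ r and none otherwise.
module LinearCongruence (G : ℕ) .{{_ : NonZero G}} (s L r : ℕ) (G∣sL : G ∣ s * L) where

  d = gcd s G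
  instance
    d≢0 : NonZero d
    d≢0 = ≢-nonZero (gcd[m,n]≢0 s G (inj₂ (≢-nonZero⁻¹ G)))

  e  = G / d
  s′ = s / d
  instance
    e≢0 : NonZero e
    e≢0 = ≢-nonZero (n/gcd[m,n]≢0 s G)

  G≡de : G ≡ d * e
  G≡de = sym (m*[n/m]≡n (gcd[m,n]∣n s G))

  s≡ds′ : s ≡ d * s′
  s≡ds′ = sym (m*[n/m]≡n (gcd[m,n]∣m s G))

  -- G ∣ s y forces e ∣ y, since s/d and e are coprime.
  e∣ : ∀ y → G ∣ s * y → e ∣ y
  e∣ y G∣sy = coprime-divisor (Coprimality.sym (coprime-/gcd s G))
    (*-cancelˡ-∣ d (subst₂ _∣_ G≡de (trans (cong (_* y) s≡ds′) (*-assoc d s′ y)) G∣sy))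

  G∣se : G ∣ s * e
  G∣se = divides s′ (begin
    s * e       ≡⟨ cong (_* e) s≡ds′ ⟩
    d * s′ * e  ≡⟨ regroup d s′ e ⟩
    s′ * (d * e) ≡⟨ cong (s′ *_) (sym G≡de) ⟩
    s′ * G      ∎)
    where open ≡-Reasoning
          regroup : ∀ a b c → a * b * c ≡ b * (a * c)
          regroup = solve-∀

  Solution : ℕ → Set
  Solution x = G ∣ r + s * x

  solution? : ∀ x → Dec (Solution x)
  solution? x = G ∣? (r + s * x)

  shift : ∀ x k → Solution (x + k * e) → Solution x
  shift x k sol = ∣m+n∣m⇒∣n (subst (G ∣_) (expand r s x k e) sol) (∣n⇒∣m*n k G∣se)
    where expand : ∀ r s x k e → r + s * (x + k * e) ≡ k * (s * e) + (r + s * x)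
          expand = solve-∀

  periodic : ∀ x → 𝟙 (solution? (e + x)) ≡ 𝟙 (solution? x)
  periodic x = 𝟙-cong (solution? (e + x)) (solution? x)
    (λ sol → shift x 1 (subst Solution (one-period e x) sol))
    (λ sol → subst (G ∣_) (expand r s e x) (∣m∣n⇒∣m+n sol G∣se))
    where
      one-period : ∀ e x → e + x ≡ x + 1 * e
      one-period = solve-∀
      expand : ∀ r s e x → r + s * x + s * e ≡ r + s * (e + x)
      expand = solve-∀

  unique≤ : ∀ x y → x ≤ y → y < e → Solution x → Solution y → x ≡ y
  unique≤ x y x≤y y<e solx soly = ≤-antisym x≤y (m∸n≡0⇒m≤n δ≡0)
    where
      δ = y ∸ x
      G∣sδ : G ∣ s * δ
      G∣sδ = ∣m+n∣m⇒∣n (subst (G ∣_) (split r s x δ) (subst Solution (sym (m+[n∸m]≡n x≤y)) soly)) solx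
        where split : ∀ r s x δ → r + s * (x + δ) ≡ (r + s * x) + s * δ
              split = solve-∀
      δ≡0 : δ ≡ 0
      δ≡0 = multiple-below⇒zero (e∣ δ G∣sδ) (≤-<-trans (m∸n≤m y x) y<e)

  unique : ∀ x y → x < e → y < e → Solution x → Solution y → x ≡ y
  unique x y x<e y<e solx soly with ≤-total x y
  ... | inj₁ x≤y = unique≤ x y x≤y y<e solx soly
  ... | inj₂ y≤x = sym (unique≤ y x y≤x x<e soly solx)

  count-period : ∑< e (𝟙 ∘ solution?) ≡ 𝟙 (d ∣? r)
  count-period with d ∣? r
  ... | yes d∣r = ∑<-unique e solution? x₀ (m%n<n N e) sol₀
                    (λ x x<e sol → unique x x₀ x<e (m%n<n N e) sol sol₀)
    where
      N  = proj₁ (congruence-solvable s G r d∣r)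
      x₀ = N % e
      sol₀ : Solution x₀
      sol₀ = shift x₀ (N / e) (subst Solution (m≡m%n+[m/n]*n N e) (proj₂ (congruence-solvable s G r d∣r)))
  ... | no d∤r = ∑<-zero e _ (λ x _ → 𝟙-no (solution? x) (λ sol → d∤r (d∣r sol)))
    where
      d∣r : ∀ {x} → Solution x → d ∣ r
      d∣r {x} sol = ∣m+n∣m⇒∣n (subst (d ∣_) (+-comm r (s * x)) (∣-trans (gcd[m,n]∣n s G) sol))
                              (∣m⇒∣m*n x (gcd[m,n]∣m s G))

  count : G * ∑< L (𝟙 ∘ solution?) ≡ 𝟙 (d ∣? r) * d * L
  count = begin
      G * ∑< L F                ≡⟨ cong (λ k → G * ∑< k F) L≡te ⟩
      G * ∑< (t * e) F          ≡⟨ cong (G *_) (∑<-periodic t e F periodic) ⟩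
      G * (t * ∑< e F)          ≡⟨ cong (λ c → G * (t * c)) count-period ⟩
      G * (t * 𝟙 (d ∣? r))      ≡⟨ cong (_* (t * 𝟙 (d ∣? r))) G≡de ⟩
      d * e * (t * 𝟙 (d ∣? r))  ≡⟨ regroup d e t (𝟙 (d ∣? r)) ⟩
      𝟙 (d ∣? r) * d * (t * e)  ≡⟨ cong (𝟙 (d ∣? r) * d *_) (sym L≡te) ⟩
      𝟙 (d ∣? r) * d * L        ∎
    where
      open ≡-Reasoning
      F = 𝟙 ∘ solution?
      e∣L = e∣ L G∣sL
      t = quotient e∣L
      L≡te : L ≡ t * e
      L≡te = m∣n⇒n≡quotient*m e∣L
      regroup : ∀ d e t i → d * e * (t * i) ≡ i * d * (t * e)
      regroup = solve-∀

-- Arithmetic modulo n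

module Residues (n : ℕ) .{{_ : NonZero n}} where

  mod≡⇒∣∸ : ∀ x y → x % n ≡ y % n → n ∣ y ∸ x
  mod≡⇒∣∸ x y eq = divides (y / n ∸ x / n) (begin
      y ∸ x
    ≡⟨ cong₂ _∸_ (m≡m%n+[m/n]*n y n) (m≡m%n+[m/n]*n x n) ⟩
      (y % n + y / n * n) ∸ (x % n + x / n * n)
    ≡⟨ cong (λ z → (y % n + y / n * n) ∸ (z + x / n * n)) eq ⟩
      (y % n + y / n * n) ∸ (y % n + x / n * n)
    ≡⟨ [m+n]∸[m+o]≡n∸o (y % n) (y / n * n) (x / n * n) ⟩
      y / n * n ∸ x / n * n
    ≡⟨ sym (*-distribʳ-∸ n (y / n) (x / n)) ⟩
      (y / n ∸ x / n) * n ∎)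
    where open ≡-Reasoning

  ∣∸⇒mod≡ : ∀ x y → x ≤ y → n ∣ y ∸ x → x % n ≡ y % n
  ∣∸⇒mod≡ x y x≤y n∣y∸x = sym (trans (cong (_% n) (sym (m+[n∸m]≡n x≤y))) (%-remove-+ʳ x n∣y∸x))

  %-*ʳ : ∀ a b → (a * (b % n)) % n ≡ (a * b) % n
  %-*ʳ a b = begin
      (a * (b % n)) % n             ≡⟨ %-distribˡ-* a (b % n) n ⟩
      ((a % n) * (b % n % n)) % n   ≡⟨ cong (λ z → ((a % n) * z) % n) (m%n%n≡m%n b n) ⟩
      ((a % n) * (b % n)) % n       ≡⟨ sym (%-distribˡ-* a b n) ⟩
      (a * b) % n                   ∎
    where open ≡-Reasoning

  %-*ˡ : ∀ a b → ((a % n) * b) % n ≡ (a * b) % n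
  %-*ˡ a b = trans (cong (_% n) (*-comm (a % n) b)) (trans (%-*ʳ b a) (cong (_% n) (*-comm b a)))

  cancel : ∀ c x y → Coprime c n → (c * x) % n ≡ (c * y) % n → x % n ≡ y % n
  cancel c x y cop eq with ≤-total x y
  ... | inj₁ x≤y = ∣∸⇒mod≡ x y x≤y (coprime-divisor (Coprimality.sym cop)
                     (subst (n ∣_) (sym (*-distribˡ-∸ c y x)) (mod≡⇒∣∸ (c * x) (c * y) eq)))
  ... | inj₂ y≤x = sym (∣∸⇒mod≡ y x y≤x (coprime-divisor (Coprimality.sym cop)
                     (subst (n ∣_) (sym (*-distribˡ-∸ c x y)) (mod≡⇒∣∸ (c * y) (c * x) (sym eq)))))

  cancel^ : ∀ c k x y → Coprime c n → (c ^ k * x) % n ≡ (c ^ k * y) % n → x % n ≡ y % n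
  cancel^ c zero    x y cop eq = trans (cong (_% n) (sym (+-identityʳ x))) (trans eq (cong (_% n) (+-identityʳ y)))
  cancel^ c (suc k) x y cop eq = cancel^ c k x y cop (cancel c (c ^ k * x) (c ^ k * y) cop
    (trans (cong (_% n) (sym (*-assoc c (c ^ k) x))) (trans eq (cong (_% n) (*-assoc c (c ^ k) y)))))

  residue : ℕ → Fin n
  residue x = fromℕ< (m%n<n x n)

  toℕ-residue : ∀ x → toℕ (residue x) ≡ x % n
  toℕ-residue x = toℕ-fromℕ< (m%n<n x n)

  toℕ%n : ∀ (z : Fin n) → toℕ z % n ≡ toℕ z
  toℕ%n z = m<n⇒m%n≡m (toℕ<n z)

  residue-toℕ : ∀ (z : Fin n) → residue (toℕ z) ≡ z
  residue-toℕ z = toℕ-injective (trans (toℕ-residue (toℕ z)) (toℕ%n z))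

  residue-injective : ∀ x y → residue x ≡ residue y → x % n ≡ y % n
  residue-injective x y eq = trans (sym (toℕ-residue x)) (trans (cong toℕ eq) (toℕ-residue y))

  residue-≡ : ∀ x y → x % n ≡ y % n → residue x ≡ residue y
  residue-≡ x y eq = toℕ-injective (trans (toℕ-residue x) (trans eq (sym (toℕ-residue y))))

  ∣-resp-% : ∀ x y → x % n ≡ y % n → n ∣ x → n ∣ y
  ∣-resp-% x y eq n∣x = m%n≡0⇒n∣m y n (trans (sym eq) (n∣m⇒m%n≡0 x n n∣x))

-- Words and their base-q values

reindex : {A : Set} {a b : ℕ} → (Fin b → Fin a) → Vec A a → Vec A b
reindex σ w = tabulate (lookup w ∘ σ)

lookup-reindex : {A : Set} {a b : ℕ} (σ : Fin b → Fin a) (w : Vec A a) (k : Fin b) → lookup (reindex σ w) k ≡ lookup w (σ k)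
lookup-reindex σ w k = lookup∘tabulate (lookup w ∘ σ) k

reindex-inverse : {A : Set} {a b : ℕ} (σ : Fin b → Fin a) (τ : Fin a → Fin b) → (∀ x → τ (σ x) ≡ x) →
                  (w : Vec A b) → reindex σ (reindex τ w) ≡ w
reindex-inverse σ τ τσ w =
  trans (tabulate-cong (λ k → trans (lookup-reindex τ w (σ k)) (cong (lookup w) (τσ k)))) (tabulate∘lookup w)

word-ext : {A : Set} {l : ℕ} (u v : Vec A l) → (∀ k → lookup u k ≡ lookup v k) → u ≡ v
word-ext u v eq = trans (sym (tabulate∘lookup u)) (trans (tabulate-cong eq) (tabulate∘lookup v))

module Words (q : ℕ) where

  ∑words : ∀ l → (Vec (Fin q) l → ℕ) → ℕ
  ∑words l h = sum (List.map h (allVecs q l))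

  ∑words-cong : ∀ l {f g : Vec (Fin q) l → ℕ} → (∀ w → f w ≡ g w) → ∑words l f ≡ ∑words l g
  ∑words-cong l = sum-map-cong (allVecs q l)

  ∑words-++ : ∀ a b (h : Vec (Fin q) (a + b) → ℕ) →
              ∑words (a + b) h ≡ ∑words a (λ u → ∑words b (λ w → h (u ++ w)))
  ∑words-++ zero    b h = sym (+-identityʳ _)
  ∑words-++ (suc a) b h = begin
      sum (List.map h (concatMap (λ x → List.map (x ∷_) (allVecs q (a + b))) (allFin q)))
    ≡⟨ sum-map-concatMap _ h (allFin q) ⟩
      sum (List.map (λ x → sum (List.map h (List.map (x ∷_) (allVecs q (a + b))))) (allFin q))
    ≡⟨ sum-map-cong (allFin q) (λ x → trans (sum-map-map (x ∷_) h (allVecs q (a + b))) (∑words-++ a b (h ∘ (x ∷_)))) ⟩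
      sum (List.map (λ x → ∑words a (λ u → ∑words b (λ w → h (x ∷ (u ++ w))))) (allFin q))
    ≡⟨ sum-map-cong (allFin q) (λ x → sym (sum-map-map (x ∷_) (λ u → ∑words b (λ w → h (u ++ w))) (allVecs q a))) ⟩
      sum (List.map (λ x → sum (List.map (λ u → ∑words b (λ w → h (u ++ w))) (List.map (x ∷_) (allVecs q a)))) (allFin q))
    ≡⟨ sym (sum-map-concatMap _ _ (allFin q)) ⟩
      ∑words (suc a) (λ u → ∑words b (λ w → h (u ++ w)))
    ∎ where open ≡-Reasoning

  encode : ∀ l → Vec (Fin q) l → Fin (q ^ l)
  encode zero    []      = zero
  encode (suc l) (x ∷ w) = combine x (encode l w)

  decode : ∀ l → Fin (q ^ l) → Vec (Fin q) l
  decode zero    _ = []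
  decode (suc l) k = proj₁ (remQuot {q} (q ^ l) k) ∷ decode l (proj₂ (remQuot {q} (q ^ l) k))

  decode-combine : ∀ l x k → decode (suc l) (combine x k) ≡ x ∷ decode l k
  decode-combine l x k = cong (λ p → proj₁ p ∷ decode l (proj₂ p)) (remQuot-combine {q} {q ^ l} x k)

  decode-encode : ∀ l (w : Vec (Fin q) l) → decode l (encode l w) ≡ w
  decode-encode zero    []      = refl
  decode-encode (suc l) (x ∷ w) = trans (decode-combine l x (encode l w)) (cong (x ∷_) (decode-encode l w))

  encode-decode : ∀ l (k : Fin (q ^ l)) → encode l (decode l k) ≡ k
  encode-decode zero    zero = refl
  encode-decode (suc l) k =
    trans (cong (combine (proj₁ (remQuot {q} (q ^ l) k))) (encode-decode l (proj₂ (remQuot {q} (q ^ l) k))))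
          (combine-remQuot {q} (q ^ l) k)

  ∑words-decode : ∀ l (h : Vec (Fin q) l → ℕ) → ∑words l h ≡ ∑ (q ^ l) (h ∘ decode l)
  ∑words-decode zero    h = refl
  ∑words-decode (suc l) h = begin
      sum (List.map h (concatMap (λ x → List.map (x ∷_) (allVecs q l)) (allFin q)))
    ≡⟨ sum-map-concatMap _ h (allFin q) ⟩
      sum (List.map (λ x → sum (List.map h (List.map (x ∷_) (allVecs q l)))) (allFin q))
    ≡⟨ sum-map-cong (allFin q) (λ x → trans (sum-map-map (x ∷_) h (allVecs q l)) (∑words-decode l (h ∘ (x ∷_)))) ⟩
      sum (List.map (λ x → ∑ (q ^ l) (λ k → h (x ∷ decode l k))) (allFin q))
    ≡⟨ sum-allFin q _ ⟩
      ∑ q (λ x → ∑ (q ^ l) (λ k → h (x ∷ decode l k)))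
    ≡⟨ ∑-cong q (λ x → ∑-cong (q ^ l) (λ k → cong h (sym (decode-combine l x k)))) ⟩
      ∑ q (λ x → ∑ (q ^ l) (λ k → h (decode (suc l) (combine x k))))
    ≡⟨ sym (∑-combine q (q ^ l) (h ∘ decode (suc l))) ⟩
      ∑ (q ^ suc l) (h ∘ decode (suc l))
    ∎ where open ≡-Reasoning

  ∑words-*ˡ : ∀ l c (h : Vec (Fin q) l → ℕ) → ∑words l (λ w → c * h w) ≡ c * ∑words l h
  ∑words-*ˡ l c h =
    trans (∑words-decode l _) (trans (∑-*ˡ (q ^ l) c _) (cong (c *_) (sym (∑words-decode l h))))

  ∑words-reindex : ∀ a b (π : Fin a ↔ Fin b) (h : Vec (Fin q) b → ℕ) →
                   ∑words b h ≡ ∑words a (h ∘ reindex (Inverse.from π))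
  ∑words-reindex a b π h = begin
      ∑words b h
    ≡⟨ ∑words-decode b h ⟩
      ∑ (q ^ b) (h ∘ decode b)
    ≡⟨ FinSum.∑-permute (h ∘ decode b) relabel ⟩
      ∑ (q ^ a) (λ k → h (decode b (encode b (reindex from (decode a k)))))
    ≡⟨ ∑-cong (q ^ a) (λ k → cong h (decode-encode b _)) ⟩
      ∑ (q ^ a) (λ k → h (reindex from (decode a k)))
    ≡⟨ sym (∑words-decode a _) ⟩
      ∑words a (h ∘ reindex from)
    ∎ where
      open ≡-Reasoning
      to   = Inverse.to π
      from = Inverse.from π
      relabel : Fin (q ^ a) ↔ Fin (q ^ b)
      relabel = mk↔ₛ′ (λ k → encode b (reindex from (decode a k))) (λ k → encode a (reindex to (decode b k)))
        (λ k → trans (cong (encode b ∘ reindex from) (decode-encode a _))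
               (trans (cong (encode b) (reindex-inverse from to (Inverse.strictlyInverseˡ π) (decode b k)))
                      (encode-decode b k)))
        (λ k → trans (cong (encode a ∘ reindex to) (decode-encode b _))
               (trans (cong (encode a) (reindex-inverse to from (Inverse.strictlyInverseʳ π) (decode a k)))
                      (encode-decode a k)))

  val : ∀ {l} → Vec (Fin q) l → ℕ
  val []               = 0
  val {suc l} (x ∷ w) = q ^ l * toℕ x + val w

  toℕ-encode : ∀ l (w : Vec (Fin q) l) → toℕ (encode l w) ≡ val w
  toℕ-encode zero    []      = refl
  toℕ-encode (suc l) (x ∷ w) = trans (toℕ-combine x (encode l w)) (cong (q ^ l * toℕ x +_) (toℕ-encode l w))

  ∑words-val : ∀ l (H : ℕ → ℕ) → ∑words l (H ∘ val) ≡ ∑< (q ^ l) H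
  ∑words-val l H = begin
      ∑words l (H ∘ val)
    ≡⟨ ∑words-decode l (H ∘ val) ⟩
      ∑ (q ^ l) (H ∘ val ∘ decode l)
    ≡⟨ ∑-cong (q ^ l) (λ k → cong H (trans (sym (toℕ-encode l (decode l k))) (cong toℕ (encode-decode l k)))) ⟩
      ∑ (q ^ l) (H ∘ toℕ)
    ≡⟨ ∑-toℕ (q ^ l) H ⟩
      ∑< (q ^ l) H
    ∎ where open ≡-Reasoning

  val-injective : ∀ l (u w : Vec (Fin q) l) → val u ≡ val w → u ≡ w
  val-injective l u w eq = begin
      u                      ≡⟨ sym (decode-encode l u) ⟩
      decode l (encode l u)  ≡⟨ cong (decode l) (toℕ-injective (trans (toℕ-encode l u) (trans eq (sym (toℕ-encode l w))))) ⟩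
      decode l (encode l w)  ≡⟨ decode-encode l w ⟩
      w                      ∎
    where open ≡-Reasoning

  -- val as a digit sum: the k-th digit of a word of length l has weight q^(l-1-k).
  val-digits : ∀ l (u : Vec (Fin q) l) → ∑ l (λ k → q ^ toℕ (opposite k) * toℕ (lookup u k)) ≡ val u
  val-digits zero    []      = refl
  val-digits (suc l) (x ∷ u) = cong₂ _+_ (cong (λ t → q ^ t * toℕ x) (toℕ-fromℕ l))
    (trans (∑-cong l (λ k → cong (λ t → q ^ t * toℕ (lookup u k)) (opposite-suc k))) (val-digits l u))

-- Concatenations of blocks

-- Fin (∑ m B) is the disjoint union of the Fin (B i): pos i k is the place
-- of the k-th element of the i-th block, and unpos inverts it.
pos : ∀ m (B : Fin m → ℕ) (i : Fin m) → Fin (B i) → Fin (∑ m B)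
pos (suc m) B zero    k = k ↑ˡ ∑ m (B ∘ suc)
pos (suc m) B (suc i) k = B zero ↑ʳ pos m (B ∘ suc) i k

unpos : ∀ m (B : Fin m → ℕ) → Fin (∑ m B) → Σ (Fin m) (Fin ∘ B)
unpos (suc m) B p with splitAt (B zero) p
... | inj₁ k  = zero , k
... | inj₂ p′ = suc (proj₁ (unpos m (B ∘ suc) p′)) , proj₂ (unpos m (B ∘ suc) p′)

pos-unpos : ∀ m B p → pos m B (proj₁ (unpos m B p)) (proj₂ (unpos m B p)) ≡ p
pos-unpos (suc m) B p with splitAt (B zero) p in eq
... | inj₁ k  = trans (cong (join (B zero) _) (sym eq)) (join-splitAt (B zero) _ p)
... | inj₂ p′ = trans (cong (B zero ↑ʳ_) (pos-unpos m (B ∘ suc) p′))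
                      (trans (cong (join (B zero) _) (sym eq)) (join-splitAt (B zero) _ p))

unpos-pos : ∀ m B i k → unpos m B (pos m B i k) ≡ (i , k)
unpos-pos (suc m) B zero k rewrite splitAt-↑ˡ (B zero) k (∑ m (B ∘ suc)) = refl
unpos-pos (suc m) B (suc i) k rewrite splitAt-↑ʳ (B zero) (∑ m (B ∘ suc)) (pos m (B ∘ suc) i k)
  = cong (λ x → suc (proj₁ x) , proj₂ x) (unpos-pos m (B ∘ suc) i k)

∑-blocks : ∀ m B (H : Fin (∑ m B) → ℕ) → ∑ (∑ m B) H ≡ ∑ m (λ i → ∑ (B i) (H ∘ pos m B i))
∑-blocks zero    B H = refl
∑-blocks (suc m) B H = trans (∑-split (B zero) _ H)
  (cong (∑ (B zero) (H ∘ (_↑ˡ _)) +_) (∑-blocks m (B ∘ suc) (H ∘ (B zero ↑ʳ_))))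

block : {A : Set} (m : ℕ) (B : Fin m → ℕ) (i : Fin m) → Vec A (∑ m B) → Vec A (B i)
block m B i = reindex (pos m B i)

block-head : {A : Set} (m : ℕ) (B : Fin (suc m) → ℕ) (u : Vec A (B zero)) (w : Vec A (∑ m (B ∘ suc))) →
             block (suc m) B zero (u ++ w) ≡ u
block-head m B u w = trans (tabulate-cong (lookup-++ˡ u w)) (tabulate∘lookup u)

block-tail : {A : Set} (m : ℕ) (B : Fin (suc m) → ℕ) (u : Vec A (B zero)) (w : Vec A (∑ m (B ∘ suc))) (i : Fin m) →
             block (suc m) B (suc i) (u ++ w) ≡ block m (B ∘ suc) i w
block-tail m B u w i = tabulate-cong (λ k → lookup-++ʳ u w (pos m (B ∘ suc) i k))

-- Folds over the members of a subset

-- foldSubset c z I = c i₁ (c i₂ (… (c iₖ z))) for the members i₁ < … < iₖ of I;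
-- gcd(n, s_i : i ∈ I) and ∏_{i ∈ I} (q^ℓ_i - 1) are such folds.
foldSubset : ∀ {m} → (Fin m → ℕ → ℕ) → ℕ → Subset m → ℕ
foldSubset c z []            = z
foldSubset c z (outside ∷ I) = foldSubset (c ∘ suc) z I
foldSubset c z (inside ∷ I)  = c zero (foldSubset (c ∘ suc) z I)

filter-suc : ∀ {m} (b : Side) (I : Subset m) (xs : List (Fin m)) →
             filter (_∈? (b ∷ I)) (List.map suc xs) ≡ List.map suc (filter (_∈? I) xs)
filter-suc b I [] = refl
filter-suc b I (x ∷ xs) with does (x ∈? I)
... | true  = cong (suc x ∷_) (filter-suc b I xs)
... | false = filter-suc b I xs

foldr-members : ∀ m (I : Subset m) (c : Fin m → ℕ → ℕ) z →
                foldr c z (filter (_∈? I) (allFin m)) ≡ foldSubset c z I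
foldr-successors : ∀ m b (I : Subset m) (c : Fin (suc m) → ℕ → ℕ) z →
                   foldr c z (filter (_∈? (b ∷ I)) (List.tabulate {n = m} suc)) ≡ foldSubset (c ∘ suc) z I

foldr-members zero    []            c z = refl
foldr-members (suc m) (outside ∷ I) c z = foldr-successors m outside I c z
foldr-members (suc m) (inside ∷ I)  c z = cong (c zero) (foldr-successors m inside I c z)


foldr-successors m b I c z = begin
    foldr c z (filter (_∈? (b ∷ I)) (List.tabulate suc))
  ≡⟨ cong (foldr c z ∘ filter (_∈? (b ∷ I))) (sym (map-tabulate (λ i → i) suc)) ⟩
    foldr c z (filter (_∈? (b ∷ I)) (List.map suc (allFin m)))
  ≡⟨ cong (foldr c z) (filter-suc b I (allFin m)) ⟩
    foldr c z (List.map suc (filter (_∈? I) (allFin m)))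
  ≡⟨ foldr-map c suc z (filter (_∈? I) (allFin m)) ⟩
    foldr (c ∘ suc) z (filter (_∈? I) (allFin m))
  ≡⟨ foldr-members m I (c ∘ suc) z ⟩
    foldSubset (c ∘ suc) z I
  ∎ where open ≡-Reasoning

-- Counting block words

-- Holds outside P = P and Holds inside P = ¬ P: the side of a block decides
-- whether it must, or must not, be the all-(q-1) block.
Holds : Side → Set → Set
Holds outside P = P
Holds inside  P = ¬ P

holds? : ∀ b {P : Set} → Dec P → Dec (Holds b P)
holds? outside P? = P?
holds? inside  P? = ¬? P?

membership⇔side : ∀ {m} (I : Subset m) (i : Fin m) (P : Set) →
  ((i ∉ I → P) × (i ∈ I → ¬ P) → Holds (lookup I i) P) ×
  (Holds (lookup I i) P → (i ∉ I → P) × (i ∈ I → ¬ P))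
membership⇔side I i P with lookup I i in side
... | outside = (λ (p , _) → p (λ i∈I → outside≢inside (trans (sym side) ([]=⇒lookup i∈I))))
              , (λ p → (λ _ → p) , (λ i∈I → ⊥-elim (outside≢inside (trans (sym side) ([]=⇒lookup i∈I)))))
  where outside≢inside : outside ≢ inside
        outside≢inside ()
... | inside  = (λ (_ , ¬p) → ¬p (lookup⇒[]= i I side))
              , (λ ¬p → (λ i∉I → ⊥-elim (i∉I (lookup⇒[]= i I side))) , (λ _ → ¬p))

module BlockCount (q₁ n : ℕ) .{{_ : NonZero n}} where

  q = suc q₁
  open Words q

  top : Fin q
  top = fromℕ q₁

  topBlock : ∀ l → Vec (Fin q) l
  topBlock l = replicate l top

  suc-val-topBlock : ∀ l → suc (val (topBlock l)) ≡ q ^ l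
  suc-val-topBlock zero    = refl
  suc-val-topBlock (suc l) = begin
      suc (q ^ l * toℕ top + val (topBlock l))  ≡⟨ sym (+-suc _ _) ⟩
      q ^ l * toℕ top + suc (val (topBlock l))  ≡⟨ cong₂ (λ a b → q ^ l * a + b) (toℕ-fromℕ q₁) (suc-val-topBlock l) ⟩
      q ^ l * q₁ + q ^ l                        ≡⟨ collect (q ^ l) q₁ ⟩
      suc q₁ * q ^ l                            ∎
    where open ≡-Reasoning
          collect : ∀ a b → a * b + a ≡ suc b * a
          collect = solve-∀

  val-topBlock : ∀ l → val (topBlock l) ≡ q ^ l ∸ 1
  val-topBlock l = cong (_∸ 1) (suc-val-topBlock l)

  Fits : Side → ∀ {l} → Vec (Fin q) l → Set
  Fits b {l} u = Holds b (u ≡ topBlock l)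

  fits? : ∀ b {l} (u : Vec (Fin q) l) → Dec (Fits b u)
  fits? b {l} u = holds? b (≡-dec Fin._≟_ u (topBlock l))

  𝟙-fits : ∀ b {l} (u : Vec (Fin q) l) → 𝟙 (fits? b u) ≡ 𝟙 (holds? b (val u ≟ val (topBlock l)))
  𝟙-fits outside {l} u = 𝟙-cong (fits? outside u) (val u ≟ val (topBlock l))
    (cong val) (val-injective l u (topBlock l))
  𝟙-fits inside {l} u = 𝟙-cong (fits? inside u) (¬? (val u ≟ val (topBlock l)))
    (λ u≢top eq → u≢top (val-injective l u (topBlock l) eq)) (λ val≢ eq → val≢ (cong val eq))

  Admissible : ∀ m (ℓ : Fin m → ℕ) (I : Subset m) → Vec (Fin q) (∑ m ℓ) → Set
  Admissible m ℓ I g = ∀ i → Fits (lookup I i) (block m ℓ i g)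

  admissible? : ∀ m ℓ I g → Dec (Admissible m ℓ I g)
  admissible? m ℓ I g = all? (λ i → fits? (lookup I i) (block m ℓ i g))

  admissible-++ : ∀ m (ℓ : Fin (suc m) → ℕ) b I u w →
    (Admissible (suc m) ℓ (b ∷ I) (u ++ w) → Fits b u × Admissible m (ℓ ∘ suc) I w) ×
    (Fits b u × Admissible m (ℓ ∘ suc) I w → Admissible (suc m) ℓ (b ∷ I) (u ++ w))
  admissible-++ m ℓ b I u w =
      (λ adm → subst (Fits b) (block-head m ℓ u w) (adm zero)
             , λ i → subst (Fits (lookup I i)) (block-tail m ℓ u w i) (adm (suc i)))
    , λ { (fits , adm) zero    → subst (Fits b) (sym (block-head m ℓ u w)) fits
        ; (fits , adm) (suc i) → subst (Fits (lookup I i)) (sym (block-tail m ℓ u w i)) (adm i) }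

  weight : ∀ m (ℓ s : Fin m → ℕ) → Vec (Fin q) (∑ m ℓ) → ℕ
  weight m ℓ s g = ∑ m (λ i → s i * val (block m ℓ i g))

  weight-++ : ∀ m (ℓ s : Fin (suc m) → ℕ) u w →
              weight (suc m) ℓ s (u ++ w) ≡ s zero * val u + weight m (ℓ ∘ suc) (s ∘ suc) w
  weight-++ m ℓ s u w = cong₂ _+_ (cong (λ v → s zero * val v) (block-head m ℓ u w))
    (∑-cong m (λ i → cong (λ v → s (suc i) * val v) (block-tail m ℓ u w i)))

  count : ∀ m (ℓ s : Fin m → ℕ) (I : Subset m) (r : ℕ) → Vec (Fin q) (∑ m ℓ) → ℕ
  count m ℓ s I r g = 𝟙 (n ∣? (r + weight m ℓ s g)) * 𝟙 (admissible? m ℓ I g)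

  gcdOver : ∀ {m} → (Fin m → ℕ) → Subset m → ℕ
  gcdOver s = foldSubset (λ i g → gcd (s i) g) n

  prodOver : ∀ {m} → (Fin m → ℕ) → Subset m → ℕ
  prodOver ℓ = foldSubset (λ i p → (q ^ ℓ i ∸ 1) * p) 1

  gcdOver∣n : ∀ {m} (s : Fin m → ℕ) (I : Subset m) → gcdOver s I ∣ n
  gcdOver∣n s []            = ∣-refl
  gcdOver∣n s (outside ∷ I) = gcdOver∣n (s ∘ suc) I
  gcdOver∣n s (inside ∷ I)  = ∣-trans (gcd[m,n]∣n (s zero) _) (gcdOver∣n (s ∘ suc) I)

  gcdOver≢0 : ∀ {m} (s : Fin m → ℕ) (I : Subset m) → NonZero (gcdOver s I)
  gcdOver≢0 s I = ≢-nonZero (λ G≡0 → ≢-nonZero⁻¹ n (0∣⇒≡0 (subst (_∣ n) G≡0 (gcdOver∣n s I))))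

  TopVanishes : ∀ m (ℓ s : Fin m → ℕ) → Set
  TopVanishes m ℓ s = ∀ i → n ∣ s i * (q ^ ℓ i ∸ 1)

  Counted : ∀ m (ℓ s : Fin m → ℕ) (I : Subset m) → Set
  Counted m ℓ s I = ∀ r → n * ∑words (∑ m ℓ) (count m ℓ s I r) ≡ 𝟙 (gcdOver s I ∣? r) * gcdOver s I * prodOver ℓ I

  count-++ : ∀ m (ℓ s : Fin (suc m) → ℕ) b I r u w →
             count (suc m) ℓ s (b ∷ I) r (u ++ w) ≡ 𝟙 (fits? b u) * count m (ℓ ∘ suc) (s ∘ suc) I (r + s zero * val u) w
  count-++ m ℓ s b I r u w = begin
      𝟙 (n ∣? (r + weight (suc m) ℓ s (u ++ w))) * 𝟙 (admissible? (suc m) ℓ (b ∷ I) (u ++ w))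
    ≡⟨ cong₂ _*_ (𝟙-cong (n ∣? _) (n ∣? _) (subst (n ∣_) regroup) (subst (n ∣_) (sym regroup)))
                 (𝟙-cong (admissible? (suc m) ℓ (b ∷ I) (u ++ w)) (fits? b u ×-dec admissible? m (ℓ ∘ suc) I w)
                         (proj₁ (admissible-++ m ℓ b I u w)) (proj₂ (admissible-++ m ℓ b I u w))) ⟩
      divisible * 𝟙 (fits? b u ×-dec admissible? m (ℓ ∘ suc) I w)
    ≡⟨ cong (divisible *_) (𝟙-× (fits? b u) (admissible? m (ℓ ∘ suc) I w)) ⟩
      divisible * (𝟙 (fits? b u) * admissible)
    ≡⟨ swap divisible (𝟙 (fits? b u)) admissible ⟩
      𝟙 (fits? b u) * count m (ℓ ∘ suc) (s ∘ suc) I r′ w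
    ∎ where
      open ≡-Reasoning
      r′ = r + s zero * val u
      divisible  = 𝟙 (n ∣? (r′ + weight m (ℓ ∘ suc) (s ∘ suc) w))
      admissible = 𝟙 (admissible? m (ℓ ∘ suc) I w)
      regroup : r + weight (suc m) ℓ s (u ++ w) ≡ r′ + weight m (ℓ ∘ suc) (s ∘ suc) w
      regroup = trans (cong (r +_) (weight-++ m ℓ s u w)) (sym (+-assoc r _ _))
      swap : ∀ a c g → a * (c * g) ≡ c * (a * g)
      swap = solve-∀

  -- Peeling off the first block: its value x runs over 0,…,L for L = q^ℓ₀ - 1,
  -- and by the hypothesis on the remaining blocks each x contributes
  -- [G′ ∣ r + s₀ x] · G′ · P′ when the block fits its side.
  peel : ∀ m (ℓ s : Fin (suc m) → ℕ) b I r → Counted m (ℓ ∘ suc) (s ∘ suc) I →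
         n * ∑words (∑ (suc m) ℓ) (count (suc m) ℓ s (b ∷ I) r)
           ≡ ∑< (suc (val (topBlock (ℓ zero))))
                (λ x → 𝟙 (holds? b (x ≟ val (topBlock (ℓ zero))))
                       * (𝟙 (gcdOver (s ∘ suc) I ∣? (r + s zero * x)) * gcdOver (s ∘ suc) I * prodOver (ℓ ∘ suc) I))
  peel m ℓ s b I r counted = begin
      n * ∑words (ℓ₀ + T) (count (suc m) ℓ s (b ∷ I) r)
    ≡⟨ cong (n *_) (∑words-++ ℓ₀ T _) ⟩
      n * ∑words ℓ₀ (λ u → ∑words T (count (suc m) ℓ s (b ∷ I) r ∘ (u ++_)))
    ≡⟨ cong (n *_) (∑words-cong ℓ₀ (λ u → trans (∑words-cong T (count-++ m ℓ s b I r u))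
                                                (∑words-*ˡ T (𝟙 (fits? b u)) _))) ⟩
      n * ∑words ℓ₀ (λ u → 𝟙 (fits? b u) * ∑words T (rest u))
    ≡⟨ sym (∑words-*ˡ ℓ₀ n _) ⟩
      ∑words ℓ₀ (λ u → n * (𝟙 (fits? b u) * ∑words T (rest u)))
    ≡⟨ ∑words-cong ℓ₀ (λ u → trans (swap n (𝟙 (fits? b u)) _)
                                   (cong₂ _*_ (𝟙-fits b u) (counted (r + s zero * val u)))) ⟩
      ∑words ℓ₀ (E ∘ val)
    ≡⟨ ∑words-val ℓ₀ E ⟩
      ∑< (q ^ ℓ₀) E
    ≡⟨ cong (λ k → ∑< k E) (sym (suc-val-topBlock ℓ₀)) ⟩
      ∑< (suc (val (topBlock ℓ₀))) E
    ∎ where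
      open ≡-Reasoning
      ℓ₀ = ℓ zero
      T  = ∑ m (ℓ ∘ suc)
      rest : Vec (Fin q) ℓ₀ → Vec (Fin q) T → ℕ
      rest u = count m (ℓ ∘ suc) (s ∘ suc) I (r + s zero * val u)
      E : ℕ → ℕ
      E x = 𝟙 (holds? b (x ≟ val (topBlock ℓ₀)))
            * (𝟙 (gcdOver (s ∘ suc) I ∣? (r + s zero * x)) * gcdOver (s ∘ suc) I * prodOver (ℓ ∘ suc) I)
      swap : ∀ a c g → a * (c * g) ≡ c * (a * g)
      swap = solve-∀

  gcd∣top-weight : ∀ m (ℓ s : Fin (suc m) → ℕ) I → TopVanishes (suc m) ℓ s →
                   gcdOver (s ∘ suc) I ∣ s zero * val (topBlock (ℓ zero))
  gcd∣top-weight m ℓ s I vanish = ∣-trans (gcdOver∣n (s ∘ suc) I)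
    (subst (λ L → n ∣ s zero * L) (sym (val-topBlock (ℓ zero))) (vanish zero))

  blockCount : ∀ m (ℓ s : Fin m → ℕ) (I : Subset m) → TopVanishes m ℓ s → Counted m ℓ s I
  blockCount zero ℓ s [] _ r = begin
      n * (𝟙 (n ∣? (r + 0)) * 𝟙 (admissible? zero ℓ [] []) + 0)
    ≡⟨ cong₂ (λ a c → n * (a * c + 0)) (𝟙-cong (n ∣? (r + 0)) (n ∣? r) (subst (n ∣_) (+-identityʳ r))
                                                 (subst (n ∣_) (sym (+-identityʳ r))))
                                       (𝟙-yes (admissible? zero ℓ [] []) (λ ())) ⟩
      n * (𝟙 (n ∣? r) * 1 + 0)
    ≡⟨ rearrange n (𝟙 (n ∣? r)) ⟩
      𝟙 (n ∣? r) * n * 1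
    ∎ where
      open ≡-Reasoning
      rearrange : ∀ n a → n * (a * 1 + 0) ≡ a * n * 1
      rearrange = solve-∀
  -- A block outside I is the top block, of value L, and s₀ L ≡ 0 (mod G′).
  blockCount (suc m) ℓ s (outside ∷ I) vanish r = begin
      n * ∑words (∑ (suc m) ℓ) (count (suc m) ℓ s (outside ∷ I) r)
    ≡⟨ peel m ℓ s outside I r (blockCount m (ℓ ∘ suc) (s ∘ suc) I (vanish ∘ suc)) ⟩
      ∑< (suc L) (λ x → 𝟙 (x ≟ L) * F x)
    ≡⟨ ∑<-only-last L F ⟩
      𝟙 (G′ ∣? (r + s zero * L)) * G′ * P′
    ≡⟨ cong (λ i → i * G′ * P′) (𝟙-cong (G′ ∣? _) (G′ ∣? r)
         (λ G′∣r+s₀L → ∣m+n∣m⇒∣n (subst (G′ ∣_) (+-comm r _) G′∣r+s₀L) G′∣s₀L)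
         (λ G′∣r → ∣m∣n⇒∣m+n G′∣r G′∣s₀L)) ⟩
      𝟙 (G′ ∣? r) * G′ * P′
    ∎ where
      open ≡-Reasoning
      L  = val (topBlock (ℓ zero))
      G′ = gcdOver (s ∘ suc) I
      P′ = prodOver (ℓ ∘ suc) I
      G′∣s₀L = gcd∣top-weight m ℓ s I vanish
      F : ℕ → ℕ
      F x = 𝟙 (G′ ∣? (r + s zero * x)) * G′ * P′
  -- A block inside I takes every value x < L, and the congruence r + s₀ x ≡ 0
  -- (mod G′) is counted by the linear congruence lemma.
  blockCount (suc m) ℓ s (inside ∷ I) vanish r = begin
      n * ∑words (∑ (suc m) ℓ) (count (suc m) ℓ s (inside ∷ I) r)
    ≡⟨ peel m ℓ s inside I r (blockCount m (ℓ ∘ suc) (s ∘ suc) I (vanish ∘ suc)) ⟩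
      ∑< (suc L) (λ x → 𝟙 (¬? (x ≟ L)) * F x)
    ≡⟨ ∑<-except-last L F ⟩
      ∑< L F
    ≡⟨ ∑<-cong L (λ x _ → *-assoc (solution x) G′ P′) ⟩
      ∑< L (λ x → solution x * (G′ * P′))
    ≡⟨ ∑<-*ʳ L solution (G′ * P′) ⟩
      ∑< L solution * (G′ * P′)
    ≡⟨ regroup (∑< L solution) G′ P′ ⟩
      G′ * ∑< L solution * P′
    ≡⟨ cong (_* P′) (LinearCongruence.count G′ {{gcdOver≢0 (s ∘ suc) I}} (s zero) L r (gcd∣top-weight m ℓ s I vanish)) ⟩
      𝟙 (gcd (s zero) G′ ∣? r) * gcd (s zero) G′ * L * P′
    ≡⟨ *-assoc (𝟙 (gcd (s zero) G′ ∣? r) * gcd (s zero) G′) L P′ ⟩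
      𝟙 (gcd (s zero) G′ ∣? r) * gcd (s zero) G′ * (L * P′)
    ≡⟨ cong (λ k → 𝟙 (gcd (s zero) G′ ∣? r) * gcd (s zero) G′ * (k * P′)) (val-topBlock (ℓ zero)) ⟩
      𝟙 (gcd (s zero) G′ ∣? r) * gcd (s zero) G′ * ((q ^ ℓ zero ∸ 1) * P′)
    ∎ where
      open ≡-Reasoning
      L  = val (topBlock (ℓ zero))
      G′ = gcdOver (s ∘ suc) I
      P′ = prodOver (ℓ ∘ suc) I
      solution : ℕ → ℕ
      solution x = 𝟙 (G′ ∣? (r + s zero * x))
      F : ℕ → ℕ
      F x = solution x * G′ * P′
      regroup : ∀ a g p → a * (g * p) ≡ g * a * p
      regroup = solve-∀

-- The classes of z ∼ q z

module Multiples (q n : ℕ) .{{_ : NonZero n}} where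
  open Residues n

  reach : ∀ x t → Equiv q n x (residue (q ^ t * toℕ x))
  reach x zero    = subst (Equiv q n x) (sym (trans (cong residue (+-identityʳ (toℕ x))) (residue-toℕ x))) ε
  reach x (suc t) = reach x t ◅◅ (fwd step ◅ ε)
    where
      step : Step q n (residue (q ^ t * toℕ x)) (residue (q ^ suc t * toℕ x))
      step = begin
        toℕ (residue (q ^ suc t * toℕ x))   ≡⟨ toℕ-residue _ ⟩
        (q * q ^ t * toℕ x) % n             ≡⟨ cong (_% n) (*-assoc q (q ^ t) (toℕ x)) ⟩
        (q * (q ^ t * toℕ x)) % n           ≡⟨ sym (%-*ʳ q (q ^ t * toℕ x)) ⟩
        (q * ((q ^ t * toℕ x) % n)) % n     ≡⟨ cong (λ y → (q * y) % n) (sym (toℕ-residue _)) ⟩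
        (q * toℕ (residue (q ^ t * toℕ x))) % n ∎
        where open ≡-Reasoning

-- The listing S = {s, qs, …, q^(ℓ-1) s} of an element s with q^ℓ s ≡ s.
-- It is closed under z ↦ qz and its inverse, hence under ∼; when ℓ is
-- minimal it lists no element twice.
module Listing (q n : ℕ) .{{_ : NonZero n}} (cop : Coprime q n) (s : Fin n) (ℓ : ℕ)
               (ℓ>0 : 0 < ℓ) (period : (q ^ ℓ * toℕ s) % n ≡ toℕ s) where
  open Residues n

  Listed : Fin n → Set
  Listed = InClass q n s ℓ

  listed : ∀ z j → j < ℓ → toℕ z ≡ (q ^ j * toℕ s) % n → Listed z
  listed z j j<ℓ eq = fromℕ< j<ℓ , trans eq (cong (λ t → (q ^ t * toℕ s) % n) (sym (toℕ-fromℕ< j<ℓ)))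

  q⁰s : (q ^ 0 * toℕ s) % n ≡ toℕ s
  q⁰s = trans (cong (_% n) (+-identityʳ (toℕ s))) (toℕ%n s)

  self : Listed s
  self = listed s 0 ℓ>0 (sym q⁰s)

  -- Each q^j s is q times a listed element (q^(ℓ-1) s for j = 0) …
  predecessor : ∀ j → j < ℓ → ∃ λ j′ → j′ < ℓ × (q ^ j * toℕ s) % n ≡ (q * (q ^ j′ * toℕ s)) % n
  predecessor zero    _   = ℓ ∸ 1 , subst (ℓ ∸ 1 <_) 1+[ℓ∸1]≡ℓ (n<1+n (ℓ ∸ 1)) , (begin
      (q ^ 0 * toℕ s) % n          ≡⟨ q⁰s ⟩
      toℕ s                        ≡⟨ sym period ⟩
      (q ^ ℓ * toℕ s) % n          ≡⟨ cong (λ k → (q ^ k * toℕ s) % n) (sym 1+[ℓ∸1]≡ℓ) ⟩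
      (q ^ (1 + (ℓ ∸ 1)) * toℕ s) % n ≡⟨ cong (_% n) (*-assoc q (q ^ (ℓ ∸ 1)) (toℕ s)) ⟩
      (q * (q ^ (ℓ ∸ 1) * toℕ s)) % n ∎)
    where open ≡-Reasoning
          1+[ℓ∸1]≡ℓ : 1 + (ℓ ∸ 1) ≡ ℓ
          1+[ℓ∸1]≡ℓ = m+[n∸m]≡n ℓ>0
  predecessor (suc j) j<ℓ = j , <-trans (n<1+n j) j<ℓ , cong (_% n) (*-assoc q (q ^ j) (toℕ s))

  -- … and q times a listed element is listed (q^ℓ s ≡ s wraps around).
  successor : ∀ j → j < ℓ → ∃ λ j′ → j′ < ℓ × (q ^ suc j * toℕ s) % n ≡ (q ^ j′ * toℕ s) % n
  successor j j<ℓ with suc j <? ℓ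
  ... | yes j+1<ℓ = suc j , j+1<ℓ , refl
  ... | no  j+1≮ℓ = 0 , ℓ>0 , trans (cong (λ t → (q ^ t * toℕ s) % n) (≤-antisym j<ℓ (≮⇒≥ j+1≮ℓ)))
                                    (trans period (sym q⁰s))

  step-closed : ∀ x y → SymClosure (Step q n) x y → Listed y → Listed x
  step-closed x y (fwd y≡qx) (k , y≡) with predecessor (toℕ k) (toℕ<n k)
  ... | j′ , j′<ℓ , eq = listed x j′ j′<ℓ
    (trans (sym (toℕ%n x)) (cancel q (toℕ x) (q ^ j′ * toℕ s) cop (trans (sym y≡qx) (trans y≡ eq))))
  step-closed x y (bwd x≡qy) (k , y≡) with successor (toℕ k) (toℕ<n k)
  ... | j′ , j′<ℓ , eq = listed x j′ j′<ℓ (begin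
      toℕ x                               ≡⟨ x≡qy ⟩
      (q * toℕ y) % n                     ≡⟨ cong (λ z → (q * z) % n) y≡ ⟩
      (q * ((q ^ toℕ k * toℕ s) % n)) % n ≡⟨ %-*ʳ q (q ^ toℕ k * toℕ s) ⟩
      (q * (q ^ toℕ k * toℕ s)) % n       ≡⟨ cong (_% n) (sym (*-assoc q (q ^ toℕ k) (toℕ s))) ⟩
      (q ^ suc (toℕ k) * toℕ s) % n       ≡⟨ eq ⟩
      (q ^ j′ * toℕ s) % n                ∎)
    where open ≡-Reasoning

  closed : ∀ x y → Equiv q n x y → Listed y → Listed x
  closed x .x ε                   listed-y = listed-y
  closed x y  (x∼z ◅ z∼y) listed-y = step-closed x _ x∼z (closed _ y z∼y listed-y)

  module Minimal (minimal : ∀ k → 0 < k → k < ℓ → ¬ ((q ^ k * toℕ s) % n ≡ toℕ s)) where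

    exponent-unique≤ : ∀ a b → a ≤ b → b < ℓ → (q ^ a * toℕ s) % n ≡ (q ^ b * toℕ s) % n → a ≡ b
    exponent-unique≤ a b a≤b b<ℓ eq with b ∸ a in b∸a≡
    ... | zero  = ≤-antisym a≤b (m∸n≡0⇒m≤n b∸a≡)
    ... | suc k = ⊥-elim (minimal (suc k) (s≤s z≤n) (subst (_< ℓ) b∸a≡ (≤-<-trans (m∸n≤m b a) b<ℓ))
        (trans (sym (cancel^ q a (toℕ s) (q ^ suc k * toℕ s) cop (trans eq shifted))) (toℕ%n s)))
      where
        shifted : (q ^ b * toℕ s) % n ≡ (q ^ a * (q ^ suc k * toℕ s)) % n
        shifted = cong (_% n) (begin
          q ^ b * toℕ s                  ≡⟨ cong (λ t → q ^ t * toℕ s) (sym (m+[n∸m]≡n a≤b)) ⟩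
          q ^ (a + (b ∸ a)) * toℕ s      ≡⟨ cong (λ t → q ^ (a + t) * toℕ s) b∸a≡ ⟩
          q ^ (a + suc k) * toℕ s        ≡⟨ cong (_* toℕ s) (^-distribˡ-+-* q a (suc k)) ⟩
          q ^ a * q ^ suc k * toℕ s      ≡⟨ *-assoc (q ^ a) _ (toℕ s) ⟩
          q ^ a * (q ^ suc k * toℕ s)    ∎)
          where open ≡-Reasoning

    exponent-injective : ∀ (a b : Fin ℓ) → (q ^ toℕ a * toℕ s) % n ≡ (q ^ toℕ b * toℕ s) % n → a ≡ b
    exponent-injective a b eq with ≤-total (toℕ a) (toℕ b)
    ... | inj₁ a≤b = toℕ-injective (exponent-unique≤ (toℕ a) (toℕ b) a≤b (toℕ<n b) eq)
    ... | inj₂ b≤a = toℕ-injective (sym (exponent-unique≤ (toℕ b) (toℕ a) b≤a (toℕ<n a) (sym eq)))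

-- Transporting 𝓕_I to block words

module Relabelling (q₁ n : ℕ) .{{_ : NonZero n}} (cop : Coprime (suc q₁) n) (m : ℕ) (s : Fin m → Fin n)
  (cover    : ∀ z → ∃ λ i → Equiv (suc q₁) n z (s i))
  (distinct : ∀ i j → Equiv (suc q₁) n (s i) (s j) → i ≡ j)
  (ℓ : Fin m → ℕ)
  (ℓ>0     : ∀ i → 0 < ℓ i)
  (period  : ∀ i → (suc q₁ ^ ℓ i * toℕ (s i)) % n ≡ toℕ (s i))
  (minimal : ∀ i k → 0 < k → k < ℓ i → ¬ ((suc q₁ ^ k * toℕ (s i)) % n ≡ toℕ (s i))) where

  open Residues n
  open BlockCount q₁ n
  open Words q
  open Multiples q n

  module Listingᵢ (i : Fin m) = Listing q n cop (s i) (ℓ i) (ℓ>0 i) (period i)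

  S : Fin m → ℕ
  S i = toℕ (s i)

  -- The orbit decomposition: place (i , k) = q^(ℓ_i-1-k) s_i is the element
  -- of ℤ_n sitting at the k-th place of the i-th block.
  Place = Σ (Fin m) (Fin ∘ ℓ)

  place : Place → Fin n
  place (i , k) = residue (q ^ toℕ (opposite k) * S i)

  listed⇒place : ∀ i z → InClass q n (s i) (ℓ i) z → Σ (Fin (ℓ i)) λ k → place (i , k) ≡ z
  listed⇒place i z (k , z≡) = opposite k , toℕ-injective (begin
      toℕ (place (i , opposite k))               ≡⟨ toℕ-residue _ ⟩
      (q ^ toℕ (opposite (opposite k)) * S i) % n ≡⟨ cong (λ k′ → (q ^ toℕ k′ * S i) % n) (opposite-involutive k) ⟩
      (q ^ toℕ k * S i) % n                      ≡⟨ sym z≡ ⟩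
      toℕ z                                      ∎)
    where open ≡-Reasoning

  place-listed : ∀ i k → InClass q n (s i) (ℓ i) (place (i , k))
  place-listed i k = opposite k , toℕ-residue _

  -- Every element is equivalent to some s_i, hence listed in S_i.
  place-surjective : ∀ z → Σ Place λ p → place p ≡ z
  place-surjective z with cover z
  ... | i , z∼sᵢ with listed⇒place i z (Listingᵢ.closed i z (s i) z∼sᵢ (Listingᵢ.self i))
  ... | k , eq = (i , k) , eq

  same-block : ∀ i j a b → (q ^ a * S i) % n ≡ (q ^ b * S j) % n → i ≡ j
  same-block i j a b eq = distinct i j (reach (s i) a ◅◅ subst (λ w → Equiv q n w (s j)) (sym (residue-≡ _ _ eq))
                                                              (EqClosure.symmetric (Step q n) (reach (s j) b)))

  place-injective : ∀ p p′ → place p ≡ place p′ → p ≡ p′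
  place-injective (i , a) (j , b) eq with same-block i j (toℕ (opposite a)) (toℕ (opposite b)) (residue-injective _ _ eq)
  ... | refl = cong (i ,_) (begin
      a                       ≡⟨ sym (opposite-involutive a) ⟩
      opposite (opposite a)   ≡⟨ cong opposite (Listingᵢ.Minimal.exponent-injective i (minimal i) (opposite a) (opposite b)
                                                  (residue-injective _ _ eq)) ⟩
      opposite (opposite b)   ≡⟨ opposite-involutive b ⟩
      b                       ∎)
    where open ≡-Reasoning

  T = ∑ m ℓ

  toℤ : Fin T → Fin n
  toℤ = place ∘ unpos m ℓ

  fromℤ : Fin n → Fin T
  fromℤ z = pos m ℓ (proj₁ (proj₁ (place-surjective z))) (proj₂ (proj₁ (place-surjective z)))

  toℤ-pos : ∀ i k → toℤ (pos m ℓ i k) ≡ place (i , k)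
  toℤ-pos i k = cong place (unpos-pos m ℓ i k)

  fromℤ-toℤ : ∀ p → fromℤ (toℤ p) ≡ p
  fromℤ-toℤ p = trans (cong (λ x → pos m ℓ (proj₁ x) (proj₂ x)) (place-injective _ _ (proj₂ (place-surjective (toℤ p)))))
                      (pos-unpos m ℓ p)

  relabel : Fin T ↔ Fin n
  relabel = mk↔ₛ′ toℤ fromℤ (λ z → trans (toℤ-pos _ _) (proj₂ (place-surjective z))) fromℤ-toℤ

  spread : Vec (Fin q) T → Vec (Fin q) n
  spread = reindex fromℤ

  lookup-spread : ∀ g i k → lookup (spread g) (place (i , k)) ≡ lookup (block m ℓ i g) k
  lookup-spread g i k = begin
      lookup (spread g) (place (i , k))   ≡⟨ lookup-reindex fromℤ g _ ⟩
      lookup g (fromℤ (place (i , k)))    ≡⟨ cong (lookup g ∘ fromℤ) (sym (toℤ-pos i k)) ⟩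
      lookup g (fromℤ (toℤ (pos m ℓ i k))) ≡⟨ cong (lookup g) (fromℤ-toℤ _) ⟩
      lookup g (pos m ℓ i k)              ≡⟨ sym (lookup-reindex (pos m ℓ i) g k) ⟩
      lookup (block m ℓ i g) k            ∎
    where open ≡-Reasoning

  toℕ-top : ∀ l (k : Fin l) → toℕ (lookup (topBlock l) k) ≡ q₁
  toℕ-top l k = trans (cong toℕ (lookup-replicate k top)) (toℕ-fromℕ q₁)

  class⇒top : ∀ g i → ClassInL q n (s i) (ℓ i) (spread g) → block m ℓ i g ≡ topBlock (ℓ i)
  class⇒top g i inL = word-ext _ _ (λ k → toℕ-injective (begin
      toℕ (lookup (block m ℓ i g) k)          ≡⟨ cong toℕ (sym (lookup-spread g i k)) ⟩
      toℕ (lookup (spread g) (place (i , k))) ≡⟨ inL (place (i , k)) (place-listed i k) ⟩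
      q₁                                      ≡⟨ sym (toℕ-top (ℓ i) k) ⟩
      toℕ (lookup (topBlock (ℓ i)) k)         ∎))
    where open ≡-Reasoning

  top⇒class : ∀ g i → block m ℓ i g ≡ topBlock (ℓ i) → ClassInL q n (s i) (ℓ i) (spread g)
  top⇒class g i block≡top z listed with listed⇒place i z listed
  ... | k , refl = trans (cong toℕ (lookup-spread g i k))
                         (trans (cong (λ u → toℕ (lookup u k)) block≡top) (toℕ-top (ℓ i) k))

  block-weight : ∀ i (u : Vec (Fin q) (ℓ i)) →
                 ∑ (ℓ i) (λ k → toℕ (place (i , k)) * toℕ (lookup u k)) % n ≡ (S i * val u) % n
  block-weight i u = trans
    (∑-mod n (ℓ i) _ (λ k → q ^ toℕ (opposite k) * S i * toℕ (lookup u k)) (λ k →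
      trans (cong (λ x → (x * toℕ (lookup u k)) % n) (toℕ-residue _)) (%-*ˡ (q ^ toℕ (opposite k) * S i) _)))
    (cong (_% n) (begin
        ∑ (ℓ i) (λ k → q ^ toℕ (opposite k) * S i * toℕ (lookup u k))
      ≡⟨ ∑-cong (ℓ i) (λ k → regroup (q ^ toℕ (opposite k)) (S i) _) ⟩
        ∑ (ℓ i) (λ k → S i * (q ^ toℕ (opposite k) * toℕ (lookup u k)))
      ≡⟨ ∑-*ˡ (ℓ i) (S i) _ ⟩
        S i * ∑ (ℓ i) (λ k → q ^ toℕ (opposite k) * toℕ (lookup u k))
      ≡⟨ cong (S i *_) (val-digits (ℓ i) u) ⟩
        S i * val u
      ∎))
    where open ≡-Reasoning
          regroup : ∀ a b c → a * b * c ≡ b * (a * c)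
          regroup = solve-∀

  weightSum-spread : ∀ g → weightSum (spread g) % n ≡ weight m ℓ S g % n
  weightSum-spread g = trans (cong (_% n) (begin
        weightSum (spread g)
      ≡⟨ sum-allFin n H ⟩
        ∑ n H
      ≡⟨ FinSum.∑-permute H relabel ⟩
        ∑ T (H ∘ toℤ)
      ≡⟨ ∑-blocks m ℓ (H ∘ toℤ) ⟩
        ∑ m (λ i → ∑ (ℓ i) (H ∘ toℤ ∘ pos m ℓ i))
      ≡⟨ ∑-cong m (λ i → ∑-cong (ℓ i) (λ k → by-place i k)) ⟩
        ∑ m (λ i → ∑ (ℓ i) (λ k → toℕ (place (i , k)) * toℕ (lookup (block m ℓ i g) k)))
      ∎))
    (∑-mod n m _ _ (λ i → block-weight i (block m ℓ i g)))
    where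
      open ≡-Reasoning
      H : Fin n → ℕ
      H z = toℕ z * toℕ (lookup (spread g) z)
      by-place : ∀ i k → H (toℤ (pos m ℓ i k)) ≡ toℕ (place (i , k)) * toℕ (lookup (block m ℓ i g) k)
      by-place i k = trans (cong H (toℤ-pos i k)) (cong (λ x → toℕ (place (i , k)) * toℕ x) (lookup-spread g i k))

  Holds-map : ∀ b {P Q : Set} → (P → Q) → (Q → P) → Holds b P → Holds b Q
  Holds-map outside f g p  = f p
  Holds-map inside  f g ¬p = ¬p ∘ g

  𝟙-inFI : ∀ I g → 𝟙 (inFI? q n m s ℓ I (spread g)) ≡ count m ℓ S I 0 g
  𝟙-inFI I g = trans (𝟙-cong (inFI? q n m s ℓ I (spread g)) ((n ∣? (0 + weight m ℓ S g)) ×-dec admissible? m ℓ I g)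
      (λ (n∣ , classes) → ∣-resp-% _ _ (weightSum-spread g) n∣ , λ i →
         Holds-map (lookup I i) (class⇒top g i) (top⇒class g i) (proj₁ (membership⇔side I i _) (classes i)))
      (λ (n∣ , adm) → ∣-resp-% _ _ (sym (weightSum-spread g)) n∣ , λ i →
         proj₂ (membership⇔side I i _) (Holds-map (lookup I i) (top⇒class g i) (class⇒top g i) (adm i))))
    (𝟙-× (n ∣? (0 + weight m ℓ S g)) (admissible? m ℓ I g))

  -- s_i (q^ℓ_i - 1) ≡ 0 (mod n), since q^ℓ_i s_i ≡ s_i.
  top-vanishes : TopVanishes m ℓ S
  top-vanishes i = subst (n ∣_) factor (mod≡⇒∣∸ (S i) (q ^ ℓ i * S i) (trans (toℕ%n (s i)) (sym (period i))))
    where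
      factor : q ^ ℓ i * S i ∸ S i ≡ S i * (q ^ ℓ i ∸ 1)
      factor = sym (trans (*-distribˡ-∸ (S i) (q ^ ℓ i) 1) (cong₂ _∸_ (*-comm (S i) (q ^ ℓ i)) (*-identityʳ (S i))))

  gcdI≡gcdOver : ∀ I → gcdI n m s I ≡ gcdOver S I
  gcdI≡gcdOver I = foldr-members m I _ n

  prodI≡prodOver : ∀ I → prodI q m ℓ I ≡ prodOver ℓ I
  prodI≡prodOver I = trans (foldr-map _*_ (λ i → q ^ ℓ i ∸ 1) 1 (filter (_∈? I) (allFin m))) (foldr-members m I _ 1)

lemma3p4 : (q n : ℕ) .{{_ : NonZero q}} .{{_ : NonZero n}} → Coprime q n →
    (m : ℕ) (s : Fin m → Fin n) →
    (∀ z → ∃ λ i → Equiv q n z (s i)) →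
    (∀ i j → Equiv q n (s i) (s j) → i ≡ j) →
    (ℓ : Fin m → ℕ) →
    (∀ i → 0 < ℓ i) →
    (∀ i → (q ^ ℓ i * toℕ (s i)) % n ≡ toℕ (s i)) →
    (∀ i k → 0 < k → k < ℓ i → ¬ ((q ^ k * toℕ (s i)) % n ≡ toℕ (s i))) →
    (I : Subset m) →
    n * cardFI q n m s ℓ I ≡ gcdI n m s I * prodI q m ℓ I
lemma3p4 (suc q₁) n cop m s cover distinct ℓ ℓ>0 period minimal I = begin
    n * cardFI q n m s ℓ I
  ≡⟨ cong (n *_) (length-filter (inFI? q n m s ℓ I) (allVecs q n)) ⟩
    n * ∑words n (𝟙 ∘ inFI? q n m s ℓ I)
  ≡⟨ cong (n *_) (∑words-reindex T n relabel (𝟙 ∘ inFI? q n m s ℓ I)) ⟩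
    n * ∑words T (𝟙 ∘ inFI? q n m s ℓ I ∘ spread)
  ≡⟨ cong (n *_) (∑words-cong T (𝟙-inFI I)) ⟩
    n * ∑words T (count m ℓ S I 0)
  ≡⟨ blockCount m ℓ S I top-vanishes 0 ⟩
    𝟙 (gcdOver S I ∣? 0) * gcdOver S I * prodOver ℓ I
  ≡⟨ cong (λ i → i * gcdOver S I * prodOver ℓ I) (𝟙-yes (gcdOver S I ∣? 0) (gcdOver S I ∣0)) ⟩
    1 * gcdOver S I * prodOver ℓ I
  ≡⟨ cong₂ _*_ (trans (*-identityˡ (gcdOver S I)) (sym (gcdI≡gcdOver I))) (sym (prodI≡prodOver I)) ⟩
    gcdI n m s I * prodI q m ℓ I
  ∎ where
    open ≡-Reasoning
    open Relabelling q₁ n cop m s cover distinct ℓ ℓ>0 period minimal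
    open BlockCount q₁ n
    open Words q
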